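{- For every integer $k>1$, \[\sum_{j=1}^{k} C_j \frac{k!}{(k-j)!} = \frac{k}{k-1}.\]
   Context: Let $H_0=0$ and $H_\ell=\sum_{i=1}^{\ell}\frac{1}{i}$ for $\ell\ge 1$. For every integer $j\geq 1$, define $C_j=\frac{(-1)^j}{(j-1)!}H_{j-1}$. -}

module Defs where

open import Data.Nat as ℕ using (ℕ; zero; suc)
open import Data.Nat.Combinatorics using ()
open import Data.Nat.Base using (_!)
open import Data.Nat.Properties using (_!≢0)
open import Data.Integer as ℤ using (ℤ; +_)
open import Data.Rational as ℚ using (ℚ; _/_; _+_; _*_; 0ℚ)

H : ℕ → ℚ
H zero    = 0ℚ
H (suc ℓ) = H ℓ + (+ 1 / suc ℓ)

sign : ℕ → ℚ
sign zero    = + 1 / 1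
sign (suc j) = ℚ.- sign j

C : ℕ → ℚ
C j = sign j * ((+ 1 / ((j ℕ.∸ 1) !)) {{(j ℕ.∸ 1) !≢0}}) * H (j ℕ.∸ 1)

fallingRatio : ℕ → ℕ → ℚ
fallingRatio k j = (+ (k !) / ((k ℕ.∸ j) !)) {{(k ℕ.∸ j) !≢0}}

sum1 : ℕ → (ℕ → ℚ) → ℚ
sum1 zero    f = 0ℚ
sum1 (suc n) f = sum1 n f + f (suc n)

pred-nonZero : ∀ {k} → k ℕ.> 1 → ℕ.NonZero (k ℕ.∸ 1)
pred-nonZero (ℕ.s≤s (ℕ.s≤s _)) = ℕ.nonZero

-- With n = k - 1 we have k!/(k-j)! = k · (n choose j-1) · (j-1)!, so the sum is -k · T n H,
-- where T n h = Σᵢ₌₀ⁿ (-1)ⁱ (n choose i) h(i) is the binomial transform.  Pascal's rule gives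
-- T (n+1) h = T n h - T n (h ∘ suc); since H (i+1) = H i + 1/(i+1), this turns T n H into
-- -T (n-1) (i ↦ 1/(i+1)), which is -1/n by the classical identity
-- Σᵢ (-1)ⁱ (n choose i) / (a+1+i) = n! / ((a+1)(a+2)⋯(a+n+1)), proved by the same recurrence.
module Submission where

open import Data.Nat as ℕ using (ℕ; zero; suc; _>_; _≤_; _!)
open import Data.Nat.Properties as ℕ using (_!≢0; _!*_!≢0)
open import Data.Nat.Combinatorics
  using (nCk+nC[k+1]≡[n+1]C[k+1]; k>n⇒nCk≡0; nCk≡n!/k![n-k]!; k![n∸k]!∣n!)
  renaming (_C_ to _choose_)
open import Data.Nat.DivMod using (m/n*n≡m)
open import Data.Nat.Tactic.RingSolver using (solve-∀)
open import Data.Integer as ℤ using (+_)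
import Data.Integer.Properties as ℤ
open import Data.Rational as ℚ using (ℚ; _/_; _+_; _*_; _-_; -_; 0ℚ; 1ℚ; toℚᵘ)
open import Data.Rational.Properties as ℚ
  using (toℚᵘ-injective; toℚᵘ-fromℚᵘ; toℚᵘ-homo-+; toℚᵘ-homo-*)
import Data.Rational.Unnormalised as ℚᵘ
import Data.Rational.Unnormalised.Properties as ℚᵘ
open import Data.Rational.Solver using (module +-*-Solver)
open import Function using (_∘_)
open import Relation.Binary.PropositionalEquality
open ≡-Reasoning

open import Defs

open +-*-Solver using (solve; _:=_; _:+_; _:-_; _:*_; :-_)

ι : ℕ → ℚ
ι n = + n / 1

module _ where
  open import Relation.Binary.Reasoning.Setoid ℚᵘ.≃-setoid
    renaming (begin_ to beginᵘ_; _∎ to _∎ᵘ)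

  private
    toℚᵘ-/ : ∀ a d → toℚᵘ (+ a / suc d) ℚᵘ.≃ ℚᵘ.mkℚᵘ (+ a) d
    toℚᵘ-/ a d = toℚᵘ-fromℚᵘ (ℚᵘ.mkℚᵘ (+ a) d)

  ι-+ : ∀ m n → ι (m ℕ.+ n) ≡ ι m + ι n
  ι-+ m n = toℚᵘ-injective (beginᵘ
    toℚᵘ (ι (m ℕ.+ n))                        ≈⟨ toℚᵘ-/ (m ℕ.+ n) 0 ⟩
    ℚᵘ.mkℚᵘ (+ (m ℕ.+ n)) 0                   ≈⟨ ℚᵘ.*≡* (cong (ℤ._* + 1) pos-+) ⟩
    ℚᵘ.mkℚᵘ (+ m) 0 ℚᵘ.+ ℚᵘ.mkℚᵘ (+ n) 0      ≈⟨ ℚᵘ.+-cong (toℚᵘ-/ m 0) (toℚᵘ-/ n 0) ⟨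
    toℚᵘ (ι m) ℚᵘ.+ toℚᵘ (ι n)                ≈⟨ toℚᵘ-homo-+ (ι m) (ι n) ⟨
    toℚᵘ (ι m + ι n)                          ∎ᵘ)
    where
    pos-+ : + (m ℕ.+ n) ≡ + m ℤ.* + 1 ℤ.+ + n ℤ.* + 1
    pos-+ = trans (ℤ.pos-+ m n)
      (sym (cong₂ ℤ._+_ (ℤ.*-identityʳ (+ m)) (ℤ.*-identityʳ (+ n))))

  ι-* : ∀ m n → ι (m ℕ.* n) ≡ ι m * ι n
  ι-* m n = toℚᵘ-injective (beginᵘ
    toℚᵘ (ι (m ℕ.* n))                        ≈⟨ toℚᵘ-/ (m ℕ.* n) 0 ⟩
    ℚᵘ.mkℚᵘ (+ (m ℕ.* n)) 0                   ≈⟨ ℚᵘ.*≡* (cong (ℤ._* + 1) (ℤ.pos-* m n)) ⟩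
    ℚᵘ.mkℚᵘ (+ m) 0 ℚᵘ.* ℚᵘ.mkℚᵘ (+ n) 0      ≈⟨ ℚᵘ.*-cong (toℚᵘ-/ m 0) (toℚᵘ-/ n 0) ⟨
    toℚᵘ (ι m) ℚᵘ.* toℚᵘ (ι n)                ≈⟨ toℚᵘ-homo-* (ι m) (ι n) ⟨
    toℚᵘ (ι m * ι n)                          ∎ᵘ)

  /-*-ι : ∀ a d .{{_ : ℕ.NonZero d}} → (+ a / d) * ι d ≡ ι a
  /-*-ι a (suc d) = toℚᵘ-injective (beginᵘ
    toℚᵘ ((+ a / suc d) * ι (suc d))          ≈⟨ toℚᵘ-homo-* (+ a / suc d) (ι (suc d)) ⟩
    toℚᵘ (+ a / suc d) ℚᵘ.* toℚᵘ (ι (suc d))  ≈⟨ ℚᵘ.*-cong (toℚᵘ-/ a d) (toℚᵘ-/ (suc d) 0) ⟩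
    ℚᵘ.mkℚᵘ (+ a) d ℚᵘ.* ℚᵘ.mkℚᵘ (+ suc d) 0  ≈⟨ ℚᵘ.*≡* (ℤ.*-assoc (+ a) (+ suc d) (+ 1)) ⟩
    ℚᵘ.mkℚᵘ (+ a) 0                           ≈⟨ toℚᵘ-/ a 0 ⟨
    toℚᵘ (ι a)                                ∎ᵘ)

*-ι-cancelʳ : ∀ d .{{_ : ℕ.NonZero d}} x y → x * ι d ≡ y * ι d → x ≡ y
*-ι-cancelʳ d x y eq = begin
  x                          ≡⟨ *-ι-*-1/ x ⟨
  x * ι d * (+ 1 / d)        ≡⟨ cong (_* (+ 1 / d)) eq ⟩
  y * ι d * (+ 1 / d)        ≡⟨ *-ι-*-1/ y ⟩
  y                          ∎
  where
  *-ι-*-1/ : ∀ z → z * ι d * (+ 1 / d) ≡ z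
  *-ι-*-1/ z = begin
    z * ι d * (+ 1 / d)      ≡⟨ ℚ.*-assoc z (ι d) (+ 1 / d) ⟩
    z * (ι d * (+ 1 / d))    ≡⟨ cong (z *_) (trans (ℚ.*-comm (ι d) (+ 1 / d)) (/-*-ι 1 d)) ⟩
    z * 1ℚ                   ≡⟨ ℚ.*-identityʳ z ⟩
    z                        ∎

/≡ι : ∀ a b d .{{_ : ℕ.NonZero d}} → a ≡ b ℕ.* d → + a / d ≡ ι b
/≡ι a b d a≡b*d = *-ι-cancelʳ d (+ a / d) (ι b)
  (trans (/-*-ι a d) (trans (cong ι a≡b*d) (ι-* b d)))

/≡ι*1/ : ∀ a d .{{_ : ℕ.NonZero d}} → + a / d ≡ ι a * (+ 1 / d)
/≡ι*1/ a d = *-ι-cancelʳ d (+ a / d) (ι a * (+ 1 / d)) (begin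
  (+ a / d) * ι d            ≡⟨ /-*-ι a d ⟩
  ι a                        ≡⟨ ℚ.*-identityʳ (ι a) ⟨
  ι a * 1ℚ                   ≡⟨ cong (ι a *_) (/-*-ι 1 d) ⟨
  ι a * ((+ 1 / d) * ι d)    ≡⟨ ℚ.*-assoc (ι a) (+ 1 / d) (ι d) ⟨
  ι a * (+ 1 / d) * ι d      ∎)

nCk*k!*[n∸k]!≡n! : ∀ {n k} → k ≤ n → (n choose k) ℕ.* (k ! ℕ.* (n ℕ.∸ k) !) ≡ n !
nCk*k!*[n∸k]!≡n! {n} {k} k≤n = begin
  (n choose k) ℕ.* (k ! ℕ.* (n ℕ.∸ k) !)
    ≡⟨ cong (ℕ._* (k ! ℕ.* (n ℕ.∸ k) !)) (nCk≡n!/k![n-k]! k≤n) ⟩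
  n ! ℕ./ (k ! ℕ.* (n ℕ.∸ k) !) ℕ.* (k ! ℕ.* (n ℕ.∸ k) !)
    ≡⟨ m/n*n≡m (k![n∸k]!∣n! k≤n) ⟩
  n !
    ∎
  where instance _ = k !* (n ℕ.∸ k) !≢0

rising : ℕ → ℕ → ℕ
rising x zero    = 1
rising x (suc n) = x ℕ.* rising (suc x) n

rising-suc : ∀ x n → rising x (suc n) ≡ rising x n ℕ.* (x ℕ.+ n)
rising-suc x zero    = x*1≡1*[x+0] x
  where
  x*1≡1*[x+0] : ∀ x → x ℕ.* 1 ≡ 1 ℕ.* (x ℕ.+ 0)
  x*1≡1*[x+0] = solve-∀
rising-suc x (suc n) = begin
  x ℕ.* rising (suc x) (suc n)                   ≡⟨ cong (x ℕ.*_) (rising-suc (suc x) n) ⟩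
  x ℕ.* (rising (suc x) n ℕ.* (suc x ℕ.+ n))     ≡⟨ reassoc x (rising (suc x) n) n ⟩
  x ℕ.* rising (suc x) n ℕ.* (x ℕ.+ suc n)       ∎
  where
  reassoc : ∀ x r n → x ℕ.* (r ℕ.* (suc x ℕ.+ n)) ≡ x ℕ.* r ℕ.* (x ℕ.+ suc n)
  reassoc = solve-∀

rising-1 : ∀ n → rising 1 n ≡ n !
rising-1 zero    = refl
rising-1 (suc n) = begin
  rising 1 (suc n)          ≡⟨ rising-suc 1 n ⟩
  rising 1 n ℕ.* suc n      ≡⟨ cong (ℕ._* suc n) (rising-1 n) ⟩
  n ! ℕ.* suc n             ≡⟨ ℕ.*-comm (n !) (suc n) ⟩
  suc n !                   ∎

sumTo : ℕ → (ℕ → ℚ) → ℚ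
sumTo zero    f = f 0
sumTo (suc n) f = sumTo n f + f (suc n)

sum1≡sumTo∘suc : ∀ n f → sum1 (suc n) f ≡ sumTo n (f ∘ suc)
sum1≡sumTo∘suc zero    f = ℚ.+-identityˡ (f 1)
sum1≡sumTo∘suc (suc n) f = cong (_+ f (suc (suc n))) (sum1≡sumTo∘suc n f)

sumTo-cong : ∀ n {f g} → (∀ i → i ≤ n → f i ≡ g i) → sumTo n f ≡ sumTo n g
sumTo-cong zero    f≗g = f≗g 0 ℕ.z≤n
sumTo-cong (suc n) f≗g =
  cong₂ _+_ (sumTo-cong n (λ i i≤n → f≗g i (ℕ.m≤n⇒m≤1+n i≤n))) (f≗g (suc n) ℕ.≤-refl)

sumTo-+ : ∀ n f g → sumTo n (λ i → f i + g i) ≡ sumTo n f + sumTo n g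
sumTo-+ zero    f g = refl
sumTo-+ (suc n) f g = begin
  sumTo n (λ i → f i + g i) + (f (suc n) + g (suc n))
    ≡⟨ cong (_+ (f (suc n) + g (suc n))) (sumTo-+ n f g) ⟩
  sumTo n f + sumTo n g + (f (suc n) + g (suc n))
    ≡⟨ interchange (sumTo n f) (sumTo n g) (f (suc n)) (g (suc n)) ⟩
  sumTo n f + f (suc n) + (sumTo n g + g (suc n))
    ∎
  where
  interchange : ∀ a b c d → a + b + (c + d) ≡ a + c + (b + d)
  interchange = solve 4 (λ a b c d → a :+ b :+ (c :+ d) := a :+ c :+ (b :+ d)) refl

sumTo-- : ∀ n f g → sumTo n (λ i → f i - g i) ≡ sumTo n f - sumTo n g
sumTo-- zero    f g = refl
sumTo-- (suc n) f g = begin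
  sumTo n (λ i → f i - g i) + (f (suc n) - g (suc n))
    ≡⟨ cong (_+ (f (suc n) - g (suc n))) (sumTo-- n f g) ⟩
  sumTo n f - sumTo n g + (f (suc n) - g (suc n))
    ≡⟨ interchange (sumTo n f) (sumTo n g) (f (suc n)) (g (suc n)) ⟩
  sumTo n f + f (suc n) - (sumTo n g + g (suc n))
    ∎
  where
  interchange : ∀ a b c d → a - b + (c - d) ≡ a + c - (b + d)
  interchange = solve 4 (λ a b c d → a :- b :+ (c :- d) := a :+ c :- (b :+ d)) refl

sumTo-*ˡ : ∀ n c f → sumTo n (λ i → c * f i) ≡ c * sumTo n f
sumTo-*ˡ zero    c f = refl
sumTo-*ˡ (suc n) c f = trans (cong (_+ c * f (suc n)) (sumTo-*ˡ n c f))
  (sym (ℚ.*-distribˡ-+ c (sumTo n f) (f (suc n))))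

sumTo-suc : ∀ n f → sumTo (suc n) f ≡ f 0 + sumTo n (f ∘ suc)
sumTo-suc zero    f = refl
sumTo-suc (suc n) f = trans (cong (_+ f (suc (suc n))) (sumTo-suc n f))
  (ℚ.+-assoc (f 0) (sumTo n (f ∘ suc)) (f (suc (suc n))))

binomialTerm : ℕ → (ℕ → ℚ) → ℕ → ℚ
binomialTerm n h i = sign i * ι (n choose i) * h i

binomialTransform : ℕ → (ℕ → ℚ) → ℚ
binomialTransform n h = sumTo n (binomialTerm n h)

binomialTerm-zero : ∀ n h → binomialTerm n h 0 ≡ h 0
binomialTerm-zero n h = ℚ.*-identityˡ (h 0)

binomialTerm-beyond : ∀ n h → binomialTerm n h (suc n) ≡ 0ℚ
binomialTerm-beyond n h = begin
  sign (suc n) * ι (n choose suc n) * h (suc n)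
    ≡⟨ cong (λ c → sign (suc n) * ι c * h (suc n)) (k>n⇒nCk≡0 (ℕ.n<1+n n)) ⟩
  sign (suc n) * 0ℚ * h (suc n)
    ≡⟨ cong (_* h (suc n)) (ℚ.*-zeroʳ (sign (suc n))) ⟩
  0ℚ * h (suc n)
    ≡⟨ ℚ.*-zeroˡ (h (suc n)) ⟩
  0ℚ
    ∎

binomialTerm-pascal : ∀ n h i →
  binomialTerm (suc n) h (suc i) ≡ binomialTerm n h (suc i) - binomialTerm n (h ∘ suc) i
binomialTerm-pascal n h i = begin
  - sign i * ι (suc n choose suc i) * h (suc i)
    ≡⟨ cong (λ c → - sign i * c * h (suc i)) pascal ⟩
  - sign i * (ι (n choose i) + ι (n choose suc i)) * h (suc i)
    ≡⟨ distribute (sign i) (ι (n choose i)) (ι (n choose suc i)) (h (suc i)) ⟩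
  - sign i * ι (n choose suc i) * h (suc i) - sign i * ι (n choose i) * h (suc i)
    ∎
  where
  pascal : ι (suc n choose suc i) ≡ ι (n choose i) + ι (n choose suc i)
  pascal = trans (cong ι (sym (nCk+nC[k+1]≡[n+1]C[k+1] n i))) (ι-+ (n choose i) (n choose suc i))
  distribute : ∀ s a b x → - s * (a + b) * x ≡ - s * b * x - s * a * x
  distribute = solve 4 (λ s a b x → :- s :* (a :+ b) :* x := :- s :* b :* x :- s :* a :* x) refl

sumTo-binomialTerm : ∀ m n h →
  sumTo (suc n) (binomialTerm m h) ≡ h 0 + sumTo n (binomialTerm m h ∘ suc)
sumTo-binomialTerm m n h = trans (sumTo-suc n (binomialTerm m h))
  (cong (_+ sumTo n (binomialTerm m h ∘ suc)) (binomialTerm-zero m h))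

binomialTransform-suc : ∀ n h →
  binomialTransform (suc n) h ≡ binomialTransform n h - binomialTransform n (h ∘ suc)
binomialTransform-suc n h = begin
  binomialTransform (suc n) h
    ≡⟨ sumTo-binomialTerm (suc n) n h ⟩
  h 0 + sumTo n (binomialTerm (suc n) h ∘ suc)
    ≡⟨ cong (λ s → h 0 + s) (sumTo-cong n (λ i _ → binomialTerm-pascal n h i)) ⟩
  h 0 + sumTo n (λ i → binomialTerm n h (suc i) - binomialTerm n (h ∘ suc) i)
    ≡⟨ cong (λ s → h 0 + s) (sumTo-- n (binomialTerm n h ∘ suc) (binomialTerm n (h ∘ suc))) ⟩
  h 0 + (sumTo n (binomialTerm n h ∘ suc) - T[h∘suc])
    ≡⟨ ℚ.+-assoc (h 0) (sumTo n (binomialTerm n h ∘ suc)) (- T[h∘suc]) ⟨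
  h 0 + sumTo n (binomialTerm n h ∘ suc) - T[h∘suc]
    ≡⟨ cong (_- T[h∘suc]) (sumTo-binomialTerm n n h) ⟨
  binomialTransform n h + binomialTerm n h (suc n) - T[h∘suc]
    ≡⟨ cong (λ t → binomialTransform n h + t - T[h∘suc]) (binomialTerm-beyond n h) ⟩
  binomialTransform n h + 0ℚ - T[h∘suc]
    ≡⟨ cong (_- T[h∘suc]) (ℚ.+-identityʳ (binomialTransform n h)) ⟩
  binomialTransform n h - T[h∘suc]
    ∎
  where T[h∘suc] = binomialTransform n (h ∘ suc)

binomialTransform-cong : ∀ n {f g} →
  (∀ i → f i ≡ g i) → binomialTransform n f ≡ binomialTransform n g
binomialTransform-cong n f≗g = sumTo-cong n (λ i _ → cong (sign i * ι (n choose i) *_) (f≗g i))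

binomialTransform-+ : ∀ n f g →
  binomialTransform n (λ i → f i + g i) ≡ binomialTransform n f + binomialTransform n g
binomialTransform-+ n f g =
  trans (sumTo-cong n (λ i _ → ℚ.*-distribˡ-+ (sign i * ι (n choose i)) (f i) (g i)))
        (sumTo-+ n (binomialTerm n f) (binomialTerm n g))

reciprocal : ℕ → ℕ → ℚ
reciprocal a i = + 1 / (suc a ℕ.+ i)

binomialTransform-reciprocal : ∀ n a →
  binomialTransform n (reciprocal a) * ι (rising (suc a) (suc n)) ≡ ι (n !)
binomialTransform-reciprocal zero a = begin
  binomialTransform 0 (reciprocal a) * ι (suc a ℕ.* 1)
    ≡⟨ cong₂ _*_ (binomialTerm-zero 0 (reciprocal a)) (cong ι suc[a]*1≡suc[a]+0) ⟩
  (+ 1 / (suc a ℕ.+ 0)) * ι (suc a ℕ.+ 0)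
    ≡⟨ /-*-ι 1 (suc a ℕ.+ 0) ⟩
  ι 1
    ∎
  where
  suc[a]*1≡suc[a]+0 : suc a ℕ.* 1 ≡ suc a ℕ.+ 0
  suc[a]*1≡suc[a]+0 = trans (ℕ.*-identityʳ (suc a)) (sym (ℕ.+-identityʳ (suc a)))
binomialTransform-reciprocal (suc n) a = begin
  binomialTransform (suc n) (reciprocal a) * R
    ≡⟨ cong (_* R) (binomialTransform-suc n (reciprocal a)) ⟩
  (T a - binomialTransform n (reciprocal a ∘ suc)) * R
    ≡⟨ cong (λ t → (T a - t) * R) (binomialTransform-cong n reciprocal-suc) ⟩
  (T a - T (suc a)) * R
    ≡⟨ distrib (T a) (T (suc a)) R ⟩
  T a * R - T (suc a) * R
    ≡⟨ cong₂ (λ x y → T a * x - T (suc a) * y) peel-last peel-first ⟩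
  T a * (ρ (suc a) * ι (suc a ℕ.+ suc n)) - T (suc a) * (ι (suc a) * ρ (suc (suc a)))
    ≡⟨ reassociate (T a) (ρ (suc a)) (ι (suc a ℕ.+ suc n)) (T (suc a)) (ι (suc a)) (ρ (suc (suc a))) ⟩
  T a * ρ (suc a) * ι (suc a ℕ.+ suc n) - T (suc a) * ρ (suc (suc a)) * ι (suc a)
    ≡⟨ cong₂ (λ x y → x * ι (suc a ℕ.+ suc n) - y * ι (suc a))
         (binomialTransform-reciprocal n a) (binomialTransform-reciprocal n (suc a)) ⟩
  ι (n !) * ι (suc a ℕ.+ suc n) - ι (n !) * ι (suc a)
    ≡⟨ cong (λ x → ι (n !) * x - ι (n !) * ι (suc a)) (ι-+ (suc a) (suc n)) ⟩
  ι (n !) * (ι (suc a) + ι (suc n)) - ι (n !) * ι (suc a)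
    ≡⟨ telescope (ι (n !)) (ι (suc a)) (ι (suc n)) ⟩
  ι (suc n) * ι (n !)
    ≡⟨ ι-* (suc n) (n !) ⟨
  ι (suc n !)
    ∎
  where
  T : ℕ → ℚ
  T b = binomialTransform n (reciprocal b)

  ρ : ℕ → ℚ
  ρ b = ι (rising b (suc n))

  R : ℚ
  R = ι (rising (suc a) (suc (suc n)))

  reciprocal-suc : ∀ i → reciprocal a (suc i) ≡ reciprocal (suc a) i
  reciprocal-suc i = cong (λ d → + 1 / suc d) (ℕ.+-suc a i)

  peel-last : R ≡ ρ (suc a) * ι (suc a ℕ.+ suc n)
  peel-last = trans (cong ι (rising-suc (suc a) (suc n)))
                    (ι-* (rising (suc a) (suc n)) (suc a ℕ.+ suc n))

  peel-first : R ≡ ι (suc a) * ρ (suc (suc a))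
  peel-first = ι-* (suc a) (rising (suc (suc a)) (suc n))

  distrib : ∀ p q x → (p - q) * x ≡ p * x - q * x
  distrib = solve 3 (λ p q x → (p :- q) :* x := p :* x :- q :* x) refl

  reassociate : ∀ p x y q z w → p * (x * y) - q * (z * w) ≡ p * x * y - q * w * z
  reassociate = solve 6 (λ p x y q z w →
    p :* (x :* y) :- q :* (z :* w) := p :* x :* y :- q :* w :* z) refl

  telescope : ∀ f x y → f * (x + y) - f * x ≡ y * f
  telescope = solve 3 (λ f x y → f :* (x :+ y) :- f :* x := y :* f) refl

binomialTransform-reciprocal-0 : ∀ m → binomialTransform m (reciprocal 0) ≡ + 1 / suc m
binomialTransform-reciprocal-0 m = *-ι-cancelʳ (suc m !) _ _ (begin
  binomialTransform m (reciprocal 0) * ι (suc m !)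
    ≡⟨ cong (λ x → binomialTransform m (reciprocal 0) * ι x) (rising-1 (suc m)) ⟨
  binomialTransform m (reciprocal 0) * ι (rising 1 (suc m))
    ≡⟨ binomialTransform-reciprocal m 0 ⟩
  ι (m !)
    ≡⟨ ℚ.*-identityˡ (ι (m !)) ⟨
  ι 1 * ι (m !)
    ≡⟨ cong (_* ι (m !)) (/-*-ι 1 (suc m)) ⟨
  (+ 1 / suc m) * ι (suc m) * ι (m !)
    ≡⟨ ℚ.*-assoc (+ 1 / suc m) (ι (suc m)) (ι (m !)) ⟩
  (+ 1 / suc m) * (ι (suc m) * ι (m !))
    ≡⟨ cong ((+ 1 / suc m) *_) (ι-* (suc m) (m !)) ⟨
  (+ 1 / suc m) * ι (suc m !)
    ∎)
  where instance _ = suc m !≢0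

binomialTransform-H : ∀ m → binomialTransform (suc m) H ≡ - (+ 1 / suc m)
binomialTransform-H m = begin
  binomialTransform (suc m) H
    ≡⟨ binomialTransform-suc m H ⟩
  binomialTransform m H - binomialTransform m (λ i → H i + reciprocal 0 i)
    ≡⟨ cong (λ t → binomialTransform m H - t) (binomialTransform-+ m H (reciprocal 0)) ⟩
  binomialTransform m H - (binomialTransform m H + binomialTransform m (reciprocal 0))
    ≡⟨ x-[x+y]≡-y (binomialTransform m H) (binomialTransform m (reciprocal 0)) ⟩
  - binomialTransform m (reciprocal 0)
    ≡⟨ cong -_ (binomialTransform-reciprocal-0 m) ⟩
  - (+ 1 / suc m)
    ∎
  where
  x-[x+y]≡-y : ∀ x y → x - (x + y) ≡ - y
  x-[x+y]≡-y = solve 2 (λ x y → x :- (x :+ y) := :- y) refl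

C-suc*ι! : ∀ i → C (suc i) * ι (i !) ≡ - (sign i * H i)
C-suc*ι! i = begin
  - sign i * (+ 1 / i !) * H i * ι (i !)
    ≡⟨ regroup (sign i) (+ 1 / i !) (H i) (ι (i !)) ⟩
  - (sign i * H i) * ((+ 1 / i !) * ι (i !))
    ≡⟨ cong (- (sign i * H i) *_) (/-*-ι 1 (i !)) ⟩
  - (sign i * H i) * 1ℚ
    ≡⟨ ℚ.*-identityʳ (- (sign i * H i)) ⟩
  - (sign i * H i)
    ∎
  where
  instance _ = i !≢0
  regroup : ∀ s w h x → - s * w * h * x ≡ - (s * h) * (w * x)
  regroup = solve 4 (λ s w h x → :- s :* w :* h :* x := :- (s :* h) :* (w :* x)) refl

fallingRatio-suc : ∀ {n i} → i ≤ n →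
  fallingRatio (suc n) (suc i) ≡ ι (suc n) * ι (n choose i) * ι (i !)
fallingRatio-suc {n} {i} i≤n = begin
  (+ (suc n !) / (n ℕ.∸ i) !)
    ≡⟨ /≡ι (suc n !) (suc n ℕ.* (n choose i) ℕ.* i !) ((n ℕ.∸ i) !) factor ⟩
  ι (suc n ℕ.* (n choose i) ℕ.* i !)
    ≡⟨ ι-* (suc n ℕ.* (n choose i)) (i !) ⟩
  ι (suc n ℕ.* (n choose i)) * ι (i !)
    ≡⟨ cong (_* ι (i !)) (ι-* (suc n) (n choose i)) ⟩
  ι (suc n) * ι (n choose i) * ι (i !)
    ∎
  where
  instance _ = (n ℕ.∸ i) !≢0
  reassoc : ∀ a b c d → a ℕ.* (b ℕ.* (c ℕ.* d)) ≡ a ℕ.* b ℕ.* c ℕ.* d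
  reassoc = solve-∀
  factor : suc n ! ≡ suc n ℕ.* (n choose i) ℕ.* i ! ℕ.* (n ℕ.∸ i) !
  factor = trans (cong (suc n ℕ.*_) (sym (nCk*k!*[n∸k]!≡n! i≤n)))
                 (reassoc (suc n) (n choose i) (i !) ((n ℕ.∸ i) !))

C*fallingRatio : ∀ {n i} → i ≤ n →
  C (suc i) * fallingRatio (suc n) (suc i) ≡ - ι (suc n) * binomialTerm n H i
C*fallingRatio {n} {i} i≤n = begin
  C (suc i) * fallingRatio (suc n) (suc i)
    ≡⟨ cong (C (suc i) *_) (fallingRatio-suc i≤n) ⟩
  C (suc i) * (ι (suc n) * ι (n choose i) * ι (i !))
    ≡⟨ regroup (C (suc i)) (ι (suc n)) (ι (n choose i)) (ι (i !)) ⟩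
  ι (suc n) * ι (n choose i) * (C (suc i) * ι (i !))
    ≡⟨ cong (ι (suc n) * ι (n choose i) *_) (C-suc*ι! i) ⟩
  ι (suc n) * ι (n choose i) * - (sign i * H i)
    ≡⟨ regroup′ (ι (suc n)) (ι (n choose i)) (sign i) (H i) ⟩
  - ι (suc n) * binomialTerm n H i
    ∎
  where
  regroup : ∀ c k b f → c * (k * b * f) ≡ k * b * (c * f)
  regroup = solve 4 (λ c k b f → c :* (k :* b :* f) := k :* b :* (c :* f)) refl
  regroup′ : ∀ k b s h → k * b * - (s * h) ≡ - k * (s * b * h)
  regroup′ = solve 4 (λ k b s h → k :* b :* :- (s :* h) := :- k :* (s :* b :* h)) refl

theorem2p9 : (k : ℕ) → (k>1 : k > 1) →
    sum1 k (λ j → C j * fallingRatio k j)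
      ≡ (+ k / (k ℕ.∸ 1)) {{pred-nonZero k>1}}
theorem2p9 (suc (suc m)) (ℕ.s≤s (ℕ.s≤s ℕ.z≤n)) = begin
  sum1 k (λ j → C j * fallingRatio k j)
    ≡⟨ sum1≡sumTo∘suc n (λ j → C j * fallingRatio k j) ⟩
  sumTo n (λ i → C (suc i) * fallingRatio k (suc i))
    ≡⟨ sumTo-cong n (λ i i≤n → C*fallingRatio i≤n) ⟩
  sumTo n (λ i → - ι k * binomialTerm n H i)
    ≡⟨ sumTo-*ˡ n (- ι k) (binomialTerm n H) ⟩
  - ι k * binomialTransform n H
    ≡⟨ cong (- ι k *_) (binomialTransform-H m) ⟩
  - ι k * - (+ 1 / n)
    ≡⟨ neg*neg (ι k) (+ 1 / n) ⟩
  ι k * (+ 1 / n)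
    ≡⟨ /≡ι*1/ k n ⟨
  + k / n
    ∎
  where
  n = suc m
  k = suc n
  neg*neg : ∀ x y → - x * - y ≡ x * y
  neg*neg = solve 2 (λ x y → :- x :* :- y := x :* y) refl
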